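{- If $n$ and $\ell$ are both even, then \[\max(n,\ell)\ge\binom{n}{2}-\left(\frac{n}{2}+k\right),\] where $k$ is the smallest nonnegative integer such that $\gcd(n-2k-1,\ell)=1$.
   Context: All graphs are finite and simple; labels lie in $\mathbb{Z}_\ell$. In the neighborhood Lights Out game on a graph $G$, each vertex carries a label in $\mathbb{Z}_\ell$; toggling a vertex $v$ adds $1$ (mod $\ell$) to the label of every vertex of the closed neighborhood $N[v]$; the game is won when all labels are $0$. $G$ is $N$-AW if the game can be won from every initial labeling. $\max(n,\ell)$ is the maximum number of edges of an $N$-AW graph on $n$ vertices. -}

module Defs where

open import Data.Nat using (ℕ; zero; suc; _+_; _∸_; _≤_; _<_; _/_; _*_; ∣_-_∣)
open import Data.Nat.Divisibility using (_∣_)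
open import Data.Nat.ListAction using (sum)
open import Relation.Nullary using (¬_)
open import Data.Nat.GCD using (gcd)
open import Data.Nat.Combinatorics using (_C_)
open import Data.Fin using (Fin; toℕ)
open import Data.Fin.Properties using (_≟_)
open import Data.Bool using (Bool; true; false; _∨_; _∧_; if_then_else_)
open import Data.Nat using (_<ᵇ_)
open import Data.List using (List; []; _∷_; foldl; map; allFin)
open import Data.Product using (Σ; _×_; ∃)
open import Relation.Nullary.Decidable using (isYes)
open import Relation.Binary.PropositionalEquality using (_≡_)

record Graph (n : ℕ) : Set where
  field
    adj     : Fin n → Fin n → Bool
    symm    : ∀ u v → adj u v ≡ adj v u
    irrefl  : ∀ v → adj v v ≡ false
open Graph public

edgeCount : ∀ {n} → Graph n → ℕ
edgeCount {n} G =
  sum (map (λ i → sum (map (λ j → if adj G i j ∧ (toℕ i <ᵇ toℕ j) then 1 else 0)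
                           (allFin n)))
           (allFin n))

inClosedNbhd : ∀ {n} → Graph n → Fin n → Fin n → Bool
inClosedNbhd G v u = isYes (u ≟ v) ∨ adj G v u

-- Labels are stored as natural numbers and read modulo ℓ.
Labeling : ℕ → Set
Labeling n = Fin n → ℕ

toggle : ∀ {n} → Graph n → Labeling n → Fin n → Labeling n
toggle G L v u = if inClosedNbhd G v u then suc (L u) else L u

toggles : ∀ {n} → Graph n → Labeling n → List (Fin n) → Labeling n
toggles G = foldl (toggle G)

AllZero : ∀ {n} → ℕ → Labeling n → Set
AllZero ℓ L = ∀ u → ℓ ∣ L u

N-AW : ∀ {n} → ℕ → Graph n → Set
N-AW {n} ℓ G = (a : Fin n → Fin ℓ) →
  Σ (List (Fin n)) λ s → AllZero ℓ (toggles G (λ u → toℕ (a u)) s)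

-- max(n,ℓ) ≥ m : some N-AW graph on n vertices has at least m edges
MaxAtLeast : ℕ → ℕ → ℕ → Set
MaxAtLeast n ℓ m = Σ (Graph n) λ G → N-AW ℓ G × m ≤ edgeCount G

-- k is the smallest nonnegative integer with gcd(n - 2k - 1, ℓ) = 1
-- (|n - (2k+1)| is used, since gcd(x, ℓ) = gcd(|x|, ℓ))
IsLeastCoprimeShift : ℕ → ℕ → ℕ → Set
IsLeastCoprimeShift n ℓ k =
  gcd ∣ n - (2 * k + 1) ∣ ℓ ≡ 1 ×
  (∀ j → j < k → ¬ (gcd ∣ n - (2 * j + 1) ∣ ℓ ≡ 1))

-- Let n = 2h, and delete from Kₙ a perfect matching v ↔ h + v together with a star joining
-- 0 to 1, …, k, which costs h + k edges; minimality of k forces k < h. Write N[v] for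
-- closed neighbourhoods and J for the all-ones labeling. Summing all N[v], then
-- subtracting N[h + 1], …, N[h + k] once and N[h] k times, leaves (n − 2k − 1) J;
-- and n − 2k − 1 is invertible modulo ℓ, so J can be produced by toggling. Every unit
-- vector is then J − N[v] for a suitable v, up to corrections that are themselves of this
-- form, and a graph in which every unit vector can be produced is winnable.
module Submission where

open import Defs
open import Algebra.Properties.CommutativeSemigroup using (interchange)
open import Data.Bool using (Bool; true; false; _∨_; _∧_; not; if_then_else_; T)
open import Data.Bool.Properties using (T-≡; T-∨; ∧-zeroʳ; ∧-identityʳ; ∨-comm; ∨-assoc)
open import Data.Fin using (Fin; toℕ; fromℕ<)
open import Data.Fin.Properties using (toℕ-injective; toℕ<n; fromℕ<-toℕ; toℕ-fromℕ<) renaming (_≟_ to _≟ᶠ_)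
open import Data.List using (List; []; _∷_; _++_; concat; replicate; map; allFin; tabulate)
open import Data.List.Properties using (map-tabulate)
open import Data.Nat
open import Data.Nat.Properties
open import Data.Nat.Combinatorics using (_C_; nCk+nC[k+1]≡[n+1]C[k+1]; nC1≡n)
open import Data.Nat.Coprimality using (gcd≡1⇒coprime; coprime-Bézout)
open import Data.Nat.DivMod using ([m+kn]%n≡m%n; %-distribˡ-+; %-distribˡ-*; m*n/n≡m)
open import Data.Nat.Divisibility using (_∣_; divides; m%n≡0⇒n∣m)
open import Data.Nat.GCD using (gcd; gcd-zeroˡ; module Bézout)
open import Data.Nat.ListAction using (sum)
open import Data.Nat.Tactic.RingSolver using (solve-∀)
open import Data.Product using (∃; _×_; _,_; proj₂)
open import Data.Sum using (_⊎_; [_,_]′)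
open import Function using (_∘_)
open import Function.Bundles using (Equivalence)
open import Relation.Binary.PropositionalEquality
open import Relation.Nullary using (¬_; Dec; yes; no; contradiction)
open import Relation.Nullary.Decidable using (isYes)

𝟙 : Bool → ℕ
𝟙 b = if b then 1 else 0

𝟙-∧ : ∀ a b → 𝟙 (a ∧ b) ≡ 𝟙 a * 𝟙 b
𝟙-∧ true  true  = refl
𝟙-∧ true  false = refl
𝟙-∧ false b     = refl

T⇒≡true : ∀ {b} → T b → b ≡ true
T⇒≡true = Equivalence.to T-≡

¬T⇒≡false : ∀ {b} → ¬ T b → b ≡ false
¬T⇒≡false {false} _  = refl
¬T⇒≡false {true}  ¬t = contradiction _ ¬t

≡ᵇ-refl : ∀ m → (m ≡ᵇ m) ≡ true
≡ᵇ-refl m = T⇒≡true (≡⇒≡ᵇ m m refl)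

≢⇒≡ᵇ-false : ∀ {m n} → m ≢ n → (m ≡ᵇ n) ≡ false
≢⇒≡ᵇ-false {m} {n} m≢n = ¬T⇒≡false (m≢n ∘ ≡ᵇ⇒≡ m n)

≡ᵇ-sym : ∀ m n → (m ≡ᵇ n) ≡ (n ≡ᵇ m)
≡ᵇ-sym zero    zero    = refl
≡ᵇ-sym zero    (suc n) = refl
≡ᵇ-sym (suc m) zero    = refl
≡ᵇ-sym (suc m) (suc n) = ≡ᵇ-sym m n

+-cancelˡ-≡ᵇ : ∀ a m n → (a + m ≡ᵇ a + n) ≡ (m ≡ᵇ n)
+-cancelˡ-≡ᵇ zero    m n = refl
+-cancelˡ-≡ᵇ (suc a) m n = +-cancelˡ-≡ᵇ a m n

∑< : ℕ → (ℕ → ℕ) → ℕ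
∑< zero    f = 0
∑< (suc m) f = ∑< m f + f m

∑<-cong : ∀ m {f g} → (∀ i → i < m → f i ≡ g i) → ∑< m f ≡ ∑< m g
∑<-cong zero    f≗g = refl
∑<-cong (suc m) f≗g = cong₂ _+_ (∑<-cong m (λ i i<m → f≗g i (m<n⇒m<1+n i<m))) (f≗g m ≤-refl)

∑<-mono-≤ : ∀ m {f g} → (∀ i → i < m → f i ≤ g i) → ∑< m f ≤ ∑< m g
∑<-mono-≤ zero    f≤g = z≤n
∑<-mono-≤ (suc m) f≤g = +-mono-≤ (∑<-mono-≤ m (λ i i<m → f≤g i (m<n⇒m<1+n i<m))) (f≤g m ≤-refl)

∑<-+ : ∀ m (f g : ℕ → ℕ) → ∑< m (λ i → f i + g i) ≡ ∑< m f + ∑< m g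
∑<-+ zero    f g = refl
∑<-+ (suc m) f g rewrite ∑<-+ m f g = interchange +-commutativeSemigroup (∑< m f) (∑< m g) (f m) (g m)

∑<-distribˡ : ∀ m c (f : ℕ → ℕ) → ∑< m (λ i → c * f i) ≡ c * ∑< m f
∑<-distribˡ zero    c f = sym (*-zeroʳ c)
∑<-distribˡ (suc m) c f rewrite ∑<-distribˡ m c f = sym (*-distribˡ-+ c (∑< m f) (f m))

∑<-const : ∀ m c → ∑< m (λ _ → c) ≡ m * c
∑<-const zero    c = refl
∑<-const (suc m) c rewrite ∑<-const m c = +-comm (m * c) c

∑<-zero : ∀ m {f} → (∀ i → i < m → f i ≡ 0) → ∑< m f ≡ 0
∑<-zero m f≗0 = trans (trans (∑<-cong m f≗0) (∑<-const m 0)) (*-zeroʳ m)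

∑<-suc : ∀ m (f : ℕ → ℕ) → ∑< (suc m) f ≡ f 0 + ∑< m (λ i → f (suc i))
∑<-suc zero    f = sym (+-identityʳ (f 0))
∑<-suc (suc m) f rewrite ∑<-suc m f = +-assoc (f 0) (∑< m (λ i → f (suc i))) (f (suc m))

∑<-split : ∀ a b (f : ℕ → ℕ) → ∑< (a + b) f ≡ ∑< a f + ∑< b (λ i → f (a + i))
∑<-split a zero    f rewrite +-identityʳ a = sym (+-identityʳ (∑< a f))
∑<-split a (suc b) f rewrite +-suc a b | ∑<-split a b f =
  +-assoc (∑< a f) (∑< b (λ i → f (a + i))) (f (a + b))

∑<-comm : ∀ a b (f : ℕ → ℕ → ℕ) →
          ∑< a (λ i → ∑< b (λ j → f i j)) ≡ ∑< b (λ j → ∑< a (λ i → f i j))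
∑<-comm zero    b f = sym (∑<-zero b (λ _ _ → refl))
∑<-comm (suc a) b f rewrite ∑<-comm a b f = sym (∑<-+ b (λ j → ∑< a (λ i → f i j)) (f a))

∑<-select-≥ : ∀ m j (f : ℕ → ℕ) → m ≤ j → ∑< m (λ i → f i * 𝟙 (i ≡ᵇ j)) ≡ 0
∑<-select-≥ zero    j f _   = refl
∑<-select-≥ (suc m) j f m<j
  rewrite ∑<-select-≥ m j f (<⇒≤ m<j) | ≢⇒≡ᵇ-false (<⇒≢ m<j) = *-zeroʳ (f m)

∑<-select : ∀ m j (f : ℕ → ℕ) → j < m → ∑< m (λ i → f i * 𝟙 (i ≡ᵇ j)) ≡ f j
∑<-select (suc m) j f j<1+m with m ≟ j
... | yes refl rewrite ∑<-select-≥ m m f ≤-refl | ≡ᵇ-refl m = *-identityʳ (f m)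
... | no m≢j rewrite ∑<-select m j f (≤∧≢⇒< (≤-pred j<1+m) (m≢j ∘ sym)) | ≢⇒≡ᵇ-false m≢j =
  trans (cong (f j +_) (*-zeroʳ (f m))) (+-identityʳ (f j))

∑<-count≡1 : ∀ m j → j < m → ∑< m (λ i → 𝟙 (i ≡ᵇ j)) ≡ 1
∑<-count≡1 m j j<m = trans (∑<-cong m (λ i _ → sym (*-identityˡ _))) (∑<-select m j (λ _ → 1) j<m)

∑<-count≡0 : ∀ m j → m ≤ j → ∑< m (λ i → 𝟙 (i ≡ᵇ j)) ≡ 0
∑<-count≡0 m j m≤j = trans (∑<-cong m (λ i _ → sym (*-identityˡ _))) (∑<-select-≥ m j (λ _ → 1) m≤j)

∑<-partition : ∀ m {f g} → (∀ i → i < m → f i + g i ≡ 1) → ∑< m f + ∑< m g ≡ m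
∑<-partition m {f} {g} f+g≡1 =
  trans (sym (∑<-+ m f g)) (trans (∑<-cong m f+g≡1) (trans (∑<-const m 1) (*-identityʳ m)))

-- Labels are naturals read modulo ℓ = suc l; multiplying by l negates, which stands in for
-- subtraction throughout.
module Modulo (l : ℕ) where

  ℓ : ℕ
  ℓ = suc l

  -- A record rather than a bare equation of remainders, so that a and b stay inferable.
  infix 4 _≋_
  record _≋_ (a b : ℕ) : Set where
    constructor mk≋
    field %-≡ : a % ℓ ≡ b % ℓ

  ≋-refl : ∀ {a} → a ≋ a
  ≋-refl = mk≋ refl

  ≡⇒≋ : ∀ {a b} → a ≡ b → a ≋ b
  ≡⇒≋ refl = ≋-refl

  ≋-trans : ∀ {a b c} → a ≋ b → b ≋ c → a ≋ c
  ≋-trans (mk≋ p) (mk≋ q) = mk≋ (trans p q)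

  +-*ℓ⇒≋ : ∀ a b x y → a + x * ℓ ≡ b + y * ℓ → a ≋ b
  +-*ℓ⇒≋ a b x y eq =
    mk≋ (trans (sym ([m+kn]%n≡m%n a x ℓ)) (trans (cong (_% ℓ) eq) ([m+kn]%n≡m%n b y ℓ)))

  +-cong-≋ : ∀ {a b c d} → a ≋ b → c ≋ d → (a + c) ≋ (b + d)
  +-cong-≋ {a} {b} {c} {d} (mk≋ p) (mk≋ q) =
    mk≋ (trans (%-distribˡ-+ a c ℓ) (trans (cong₂ (λ x y → (x + y) % ℓ) p q) (sym (%-distribˡ-+ b d ℓ))))

  *-congˡ-≋ : ∀ c {a b} → a ≋ b → (c * a) ≋ (c * b)
  *-congˡ-≋ c {a} {b} (mk≋ p) =
    mk≋ (trans (%-distribˡ-* c a ℓ) (trans (cong (λ x → ((c % ℓ) * x) % ℓ) p) (sym (%-distribˡ-* c b ℓ))))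

  x+lx≋0 : ∀ x → x + l * x ≋ 0
  x+lx≋0 x = +-*ℓ⇒≋ _ 0 0 x (rearrange x l)
    where
    rearrange : ∀ x l → x + l * x + 0 * suc l ≡ 0 + x * suc l
    rearrange = solve-∀

  ≋0⇒ℓ∣ : ∀ {a} → a ≋ 0 → ℓ ∣ a
  ≋0⇒ℓ∣ {a} (mk≋ p) = m%n≡0⇒n∣m a ℓ p

  coprime⇒invertible : ∀ c → gcd c ℓ ≡ 1 → ∃ λ d → d * c ≋ 1
  coprime⇒invertible c gcd≡1 with coprime-Bézout (gcd≡1⇒coprime gcd≡1)
  ... | Bézout.+- x y eq = x , +-*ℓ⇒≋ (x * c) 1 0 y (trans (+-identityʳ (x * c)) (sym eq))
  -- From 1 + x c = y ℓ: since l ≡ -1, the inverse is x l.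
  ... | Bézout.-+ x y eq = x * l , +-*ℓ⇒≋ (x * l * c) 1 1 (y * l) (begin
    x * l * c + 1 * ℓ  ≡⟨ rearrange x l c ⟩
    1 + l * (1 + x * c) ≡⟨ cong (λ z → 1 + l * z) eq ⟩
    1 + l * (y * ℓ)     ≡⟨ cong suc (trans (sym (*-assoc l y ℓ)) (cong (_* ℓ) (*-comm l y))) ⟩
    1 + y * l * ℓ       ∎)
    where
    open ≡-Reasoning
    rearrange : ∀ x l c → x * l * c + 1 * suc l ≡ 1 + l * (1 + x * c)
    rearrange = solve-∀

module LightsOut {n : ℕ} (G : Graph n) (l : ℕ) where
  open Modulo l

  pressCount : List (Fin n) → Fin n → ℕ
  pressCount []      u = 0
  pressCount (v ∷ s) u = 𝟙 (inClosedNbhd G v u) + pressCount s u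

  toggles≡+pressCount : ∀ s L u → toggles G L s u ≡ L u + pressCount s u
  toggles≡+pressCount []      L u = sym (+-identityʳ (L u))
  toggles≡+pressCount (v ∷ s) L u = begin
    toggles G (toggle G L v) s u                        ≡⟨ toggles≡+pressCount s (toggle G L v) u ⟩
    toggle G L v u + pressCount s u                     ≡⟨ cong (_+ pressCount s u) (toggle≡+𝟙 (inClosedNbhd G v u)) ⟩
    L u + 𝟙 (inClosedNbhd G v u) + pressCount s u       ≡⟨ +-assoc (L u) _ _ ⟩
    L u + pressCount (v ∷ s) u                          ∎
    where
    open ≡-Reasoning
    toggle≡+𝟙 : ∀ b → (if b then suc (L u) else L u) ≡ L u + 𝟙 b
    toggle≡+𝟙 true  = +-comm 1 (L u)
    toggle≡+𝟙 false = sym (+-identityʳ (L u))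

  pressCount-++ : ∀ s t u → pressCount (s ++ t) u ≡ pressCount s u + pressCount t u
  pressCount-++ []      t u = refl
  pressCount-++ (v ∷ s) t u rewrite pressCount-++ s t u = sym (+-assoc _ (pressCount s u) (pressCount t u))

  pressCount-replicate : ∀ c s u → pressCount (concat (replicate c s)) u ≡ c * pressCount s u
  pressCount-replicate zero    s u = refl
  pressCount-replicate (suc c) s u
    rewrite pressCount-++ s (concat (replicate c s)) u | pressCount-replicate c s u = refl

  record Reachable (w : Fin n → ℕ) : Set where
    constructor reachable
    field
      presses     : List (Fin n)
      pressCount≋ : ∀ u → pressCount presses u ≋ w u

  Reachable-closedNbhd : ∀ v → Reachable (λ u → 𝟙 (inClosedNbhd G v u))
  Reachable-closedNbhd v = reachable (v ∷ []) (λ u → ≡⇒≋ (+-identityʳ _))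

  Reachable-+ : ∀ {w w′} → Reachable w → Reachable w′ → Reachable (λ u → w u + w′ u)
  Reachable-+ (reachable s p) (reachable t q) =
    reachable (s ++ t) (λ u → ≋-trans (≡⇒≋ (pressCount-++ s t u)) (+-cong-≋ (p u) (q u)))

  Reachable-* : ∀ c {w} → Reachable w → Reachable (λ u → c * w u)
  Reachable-* c (reachable s p) =
    reachable (concat (replicate c s)) (λ u → ≋-trans (≡⇒≋ (pressCount-replicate c s u)) (*-congˡ-≋ c (p u)))

  Reachable-cong : ∀ {w w′} → (∀ u → w u ≋ w′ u) → Reachable w → Reachable w′
  Reachable-cong w≋w′ (reachable s p) = reachable s (λ u → ≋-trans (p u) (w≋w′ u))

  Reachable-∑< : ∀ m (f : ℕ → Fin n → ℕ) → (∀ i → i < m → Reachable (f i)) →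
                 Reachable (λ u → ∑< m (λ i → f i u))
  Reachable-∑< zero    f _  = reachable [] (λ _ → ≋-refl)
  Reachable-∑< (suc m) f fR =
    Reachable-+ (Reachable-∑< m f (λ i i<m → fR i (m<n⇒m<1+n i<m))) (fR m ≤-refl)

  Reachable-∸ : ∀ {w v e} → Reachable w → Reachable v → (∀ u → w u + e u ≡ v u) → Reachable e
  Reachable-∸ {w} {v} {e} wR vR w+e≡v = Reachable-cong v+lw≋e (Reachable-+ vR (Reachable-* l wR))
    where
    v+lw≋e : ∀ u → v u + l * w u ≋ e u
    v+lw≋e u = +-*ℓ⇒≋ _ _ 0 (w u) (begin
      v u + l * w u + 0     ≡⟨ cong (λ z → z + l * w u + 0) (sym (w+e≡v u)) ⟩
      w u + e u + l * w u + 0 ≡⟨ rearrange (w u) (e u) l ⟩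
      e u + w u * ℓ         ∎)
      where
      open ≡-Reasoning
      rearrange : ∀ x y l → x + y + l * x + 0 ≡ y + x * suc l
      rearrange = solve-∀

  unitVectors⇒N-AW : (∀ m → m < n → Reachable (λ u → 𝟙 (toℕ u ≡ᵇ m))) → N-AW ℓ G
  unitVectors⇒N-AW δR a = presses , λ u →
    subst (ℓ ∣_) (sym (toggles≡+pressCount presses (λ v → toℕ (a v)) u))
      (≋0⇒ℓ∣ (≋-trans (+-cong-≋ (≋-refl {toℕ (a u)}) (pressCount≋ u)) (x+lx≋0 (toℕ (a u)))))
    where
    A : ℕ → ℕ
    A m with m <? n
    ... | yes m<n = toℕ (a (fromℕ< m<n))
    ... | no  _   = 0

    A-toℕ : ∀ u → A (toℕ u) ≡ toℕ (a u)
    A-toℕ u with toℕ u <? n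
    ... | yes u<n = cong (λ v → toℕ (a v)) (fromℕ<-toℕ u u<n)
    ... | no  u≮n = contradiction (toℕ<n u) u≮n

    select : ∀ u → ∑< n (λ m → l * A m * 𝟙 (toℕ u ≡ᵇ m)) ≋ l * toℕ (a u)
    select u = ≡⇒≋ (begin
      ∑< n (λ m → l * A m * 𝟙 (toℕ u ≡ᵇ m)) ≡⟨ ∑<-cong n (λ m _ → cong (λ b → l * A m * 𝟙 b) (≡ᵇ-sym (toℕ u) m)) ⟩
      ∑< n (λ m → l * A m * 𝟙 (m ≡ᵇ toℕ u)) ≡⟨ ∑<-select n (toℕ u) (λ m → l * A m) (toℕ<n u) ⟩
      l * A (toℕ u)                         ≡⟨ cong (l *_) (A-toℕ u) ⟩
      l * toℕ (a u)                         ∎)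
      where open ≡-Reasoning

    negated : Reachable (λ u → l * toℕ (a u))
    negated = Reachable-cong select
      (Reachable-∑< n (λ m u → l * A m * 𝟙 (toℕ u ≡ᵇ m)) (λ m m<n → Reachable-* (l * A m) (δR m m<n)))
    open Reachable negated

sum-allFin≡∑< : ∀ m (f : ℕ → ℕ) → sum (map (λ i → f (toℕ i)) (allFin m)) ≡ ∑< m f
sum-allFin≡∑< m f = trans (cong sum (map-tabulate {n = m} (λ i → i) (λ i → f (toℕ i)))) (sum-tabulate m f)
  where
  sum-tabulate : ∀ m (f : ℕ → ℕ) → sum (tabulate {n = m} (λ i → f (toℕ i))) ≡ ∑< m f
  sum-tabulate zero    f = refl
  sum-tabulate (suc m) f = trans (cong (f 0 +_) (sum-tabulate m (λ x → f (suc x)))) (sym (∑<-suc m f))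

∑<∑<-<ᵇ≡C2 : ∀ m → ∑< m (λ i → ∑< m (λ j → 𝟙 (i <ᵇ j))) ≡ m C 2
∑<∑<-<ᵇ≡C2 zero    = refl
∑<∑<-<ᵇ≡C2 (suc m) = begin
  ∑< (suc m) (λ i → ∑< m (λ j → 𝟙 (i <ᵇ j)) + 𝟙 (i <ᵇ m))                ≡⟨ ∑<-+ (suc m) _ _ ⟩
  ∑< m (λ i → ∑< m (λ j → 𝟙 (i <ᵇ j))) + ∑< m (λ j → 𝟙 (m <ᵇ j))
    + (∑< m (λ i → 𝟙 (i <ᵇ m)) + 𝟙 (m <ᵇ m))                              ≡⟨ cong₂ (λ x y → x + y + (∑< m (λ i → 𝟙 (i <ᵇ m)) + 𝟙 (m <ᵇ m)))
                                                                                  (∑<∑<-<ᵇ≡C2 m) none-above ⟩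
  m C 2 + 0 + (∑< m (λ i → 𝟙 (i <ᵇ m)) + 𝟙 (m <ᵇ m))                     ≡⟨ cong₂ (λ x y → m C 2 + 0 + (x + 𝟙 y)) all-below m≮m ⟩
  m C 2 + 0 + (m + 0)                                                     ≡⟨ cong₂ _+_ (+-identityʳ _) (+-identityʳ m) ⟩
  m C 2 + m                                                               ≡⟨ +-comm (m C 2) m ⟩
  m + m C 2                                                               ≡⟨ cong (_+ m C 2) (sym (nC1≡n m)) ⟩
  m C 1 + m C 2                                                           ≡⟨ nCk+nC[k+1]≡[n+1]C[k+1] m 1 ⟩
  suc m C 2                                                               ∎
  where
  open ≡-Reasoning
  all-below : ∑< m (λ i → 𝟙 (i <ᵇ m)) ≡ m
  all-below = trans (∑<-cong m (λ i i<m → cong 𝟙 (T⇒≡true (<⇒<ᵇ i<m)))) (trans (∑<-const m 1) (*-identityʳ m))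
  m≮m : (m <ᵇ m) ≡ false
  m≮m = ¬T⇒≡false (λ m<m → <-irrefl refl (<ᵇ⇒< m m m<m))
  none-above : ∑< m (λ j → 𝟙 (m <ᵇ j)) ≡ 0
  none-above = ∑<-zero m (λ j j<m → cong 𝟙 (¬T⇒≡false (λ m<j → <-asym j<m (<ᵇ⇒< m j m<j))))

isYes-≟≡≡ᵇ : ∀ {n} (u v : Fin n) → isYes (u ≟ᶠ v) ≡ (toℕ u ≡ᵇ toℕ v)
isYes-≟≡≡ᵇ u v with u ≟ᶠ v
... | yes refl = sym (≡ᵇ-refl (toℕ u))
... | no  u≢v  = sym (≢⇒≡ᵇ-false (u≢v ∘ toℕ-injective))

module Complement (R : ℕ → ℕ → Bool)
                  (R-sym : ∀ v u → R v u ≡ R u v) (R-irrefl : ∀ v → R v v ≡ false) where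

  adjᶜ : ℕ → ℕ → Bool
  adjᶜ v u = not (v ≡ᵇ u) ∧ not (R v u)

  closedᶜ : ℕ → ℕ → Bool
  closedᶜ v u = (u ≡ᵇ v) ∨ adjᶜ v u

  complement : (n : ℕ) → Graph n
  complement n = record
    { adj    = λ i j → adjᶜ (toℕ i) (toℕ j)
    ; symm   = λ i j → cong₂ (λ x y → not x ∧ not y) (≡ᵇ-sym (toℕ i) (toℕ j)) (R-sym (toℕ i) (toℕ j))
    ; irrefl = λ v → cong (λ x → not x ∧ not (R (toℕ v) (toℕ v))) (≡ᵇ-refl (toℕ v))
    }

  inClosedNbhd-complement : ∀ {n} (v u : Fin n) →
                            inClosedNbhd (complement n) v u ≡ closedᶜ (toℕ v) (toℕ u)
  inClosedNbhd-complement v u = cong (_∨ adjᶜ (toℕ v) (toℕ u)) (isYes-≟≡≡ᵇ u v)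

  𝟙-closedᶜ+𝟙-R≡1 : ∀ v u → 𝟙 (closedᶜ v u) + 𝟙 (R v u) ≡ 1
  𝟙-closedᶜ+𝟙-R≡1 v u with u ≡ᵇ v in u≡ᵇv
  ... | true rewrite ≡ᵇ⇒≡ u v (subst T (sym u≡ᵇv) _) | R-irrefl v = refl
  ... | false rewrite ≡ᵇ-sym v u | u≡ᵇv with R v u
  ...   | true  = refl
  ...   | false = refl

  edgeCount-complement : ∀ n → edgeCount (complement n) + ∑< n (λ i → ∑< n (λ j → 𝟙 (R i j ∧ (i <ᵇ j))))
                               ≡ n C 2
  edgeCount-complement n = begin
    edgeCount (complement n) + ∑< n (λ i → ∑< n (λ j → r i j))          ≡⟨ cong (_+ ∑< n (λ i → ∑< n (λ j → r i j))) edgeCount≡∑< ⟩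
    ∑< n (λ i → ∑< n (λ j → a i j)) + ∑< n (λ i → ∑< n (λ j → r i j))   ≡⟨ sym (∑<-+ n _ _) ⟩
    ∑< n (λ i → ∑< n (λ j → a i j) + ∑< n (λ j → r i j))                ≡⟨ ∑<-cong n (λ i _ → sym (∑<-+ n _ _)) ⟩
    ∑< n (λ i → ∑< n (λ j → a i j + r i j))                              ≡⟨ ∑<-cong n (λ i _ → ∑<-cong n (λ j _ → a+r≡<ᵇ i j)) ⟩
    ∑< n (λ i → ∑< n (λ j → 𝟙 (i <ᵇ j)))                                ≡⟨ ∑<∑<-<ᵇ≡C2 n ⟩
    n C 2                                                                ∎
    where
    open ≡-Reasoning
    a r : ℕ → ℕ → ℕ
    a i j = 𝟙 (adjᶜ i j ∧ (i <ᵇ j))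
    r i j = 𝟙 (R i j ∧ (i <ᵇ j))

    edgeCount≡∑< : edgeCount (complement n) ≡ ∑< n (λ i → ∑< n (λ j → a i j))
    edgeCount≡∑< = trans (sum-allFin≡∑< n (λ i → sum (map (λ j → a i (toℕ j)) (allFin n))))
                         (∑<-cong n (λ i _ → sum-allFin≡∑< n (a i)))

    a+r≡<ᵇ : ∀ i j → a i j + r i j ≡ 𝟙 (i <ᵇ j)
    a+r≡<ᵇ i j with i <ᵇ j in i<ᵇj
    ... | false rewrite ∧-zeroʳ (adjᶜ i j) | ∧-zeroʳ (R i j) = refl
    ... | true rewrite ∧-identityʳ (adjᶜ i j) | ∧-identityʳ (R i j)
                     | ≢⇒≡ᵇ-false (<⇒≢ (<ᵇ⇒< i j (subst T (sym i<ᵇj) _))) with R i j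
    ...   | true  = refl
    ...   | false = refl

𝟙-∨-exclusive : ∀ a b → (T a → ¬ T b) → 𝟙 (a ∨ b) ≡ 𝟙 a + 𝟙 b
𝟙-∨-exclusive true  true  a⇒¬b = contradiction _ (a⇒¬b _)
𝟙-∨-exclusive true  false _    = refl
𝟙-∨-exclusive false b     _    = refl

T-∨⇒⊎ : ∀ {a b} → T (a ∨ b) → T a ⊎ T b
T-∨⇒⊎ = Equivalence.to T-∨

module MatchingPlusStar (h-1 k : ℕ) (k<h : k < suc h-1) where

  h n : ℕ
  h = suc h-1
  n = h * 2

  n≡h+h : n ≡ h + h
  n≡h+h = trans (*-comm h 2) (cong (h +_) (+-identityʳ h))

  h+m<n : ∀ {m} → m < h → h + m < n
  h+m<n {m} m<h = subst (h + m <_) (sym n≡h+h) (+-monoʳ-< h m<h)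

  <h⇒<n : ∀ {m} → m < h → m < n
  <h⇒<n m<h = ≤-<-trans (m≤n+m _ h) (h+m<n m<h)

  2k+1≤n : 2 * k + 1 ≤ n
  2k+1≤n = ≤-trans (n≤1+n _) (subst (_≤ n) (double-suc k) (*-monoˡ-≤ 2 k<h))
    where
    double-suc : ∀ x → suc x * 2 ≡ suc (2 * x + 1)
    double-suc = solve-∀

  n-2k-1 : ℕ
  n-2k-1 = ∣ n - (2 * k + 1) ∣

  n-2k-1+[2k+1]≡n : n-2k-1 + (2 * k + 1) ≡ n
  n-2k-1+[2k+1]≡n = trans (cong (_+ (2 * k + 1)) (m≤n⇒∣n-m∣≡n∸m 2k+1≤n)) (m∸n+n≡m 2k+1≤n)

  inStar : ℕ → Bool
  inStar w = (1 ≤ᵇ w) ∧ (w ≤ᵇ k)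

  inStar-≤ : ∀ {w} → T (inStar w) → w ≤ k
  inStar-≤ {suc w} w∈ = ≤ᵇ⇒≤ (suc w) k w∈

  inStar-false : ∀ {w} → k < w → inStar w ≡ false
  inStar-false k<w = ¬T⇒≡false (<⇒≱ k<w ∘ inStar-≤)

  inStar-true : ∀ {w} → 1 ≤ w → w ≤ k → inStar w ≡ true
  inStar-true {suc w} _ w≤k = T⇒≡true (≤⇒≤ᵇ w≤k)

  h∉Star : ¬ T (inStar h)
  h∉Star h∈ = <⇒≱ k<h (inStar-≤ h∈)

  removed : ℕ → ℕ → Bool
  removed v u = (u ≡ᵇ h + v) ∨ ((v ≡ᵇ h + u) ∨ (((v ≡ᵇ 0) ∧ inStar u) ∨ ((u ≡ᵇ 0) ∧ inStar v)))

  removed-sym : ∀ v u → removed v u ≡ removed u v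
  removed-sym v u = begin
    a ∨ (b ∨ (c ∨ d)) ≡⟨ sym (∨-assoc a b _) ⟩
    (a ∨ b) ∨ (c ∨ d) ≡⟨ cong₂ _∨_ (∨-comm a b) (∨-comm c d) ⟩
    (b ∨ a) ∨ (d ∨ c) ≡⟨ ∨-assoc b a _ ⟩
    b ∨ (a ∨ (d ∨ c)) ∎
    where
    open ≡-Reasoning
    a = u ≡ᵇ h + v
    b = v ≡ᵇ h + u
    c = (v ≡ᵇ 0) ∧ inStar u
    d = (u ≡ᵇ 0) ∧ inStar v

  𝟙-removed : ∀ v u → 𝟙 (removed v u) ≡
              𝟙 (u ≡ᵇ h + v) + (𝟙 (v ≡ᵇ h + u) + (𝟙 ((v ≡ᵇ 0) ∧ inStar u) + 𝟙 ((u ≡ᵇ 0) ∧ inStar v)))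
  𝟙-removed v u = begin
    𝟙 (a ∨ (b ∨ (c ∨ d)))         ≡⟨ 𝟙-∨-exclusive a _ (λ ta → [ a⊥b ta , [ a⊥c ta , a⊥d ta ]′ ∘ T-∨⇒⊎ ]′ ∘ T-∨⇒⊎) ⟩
    𝟙 a + 𝟙 (b ∨ (c ∨ d))         ≡⟨ cong (𝟙 a +_) (𝟙-∨-exclusive b _ (λ tb → [ b⊥c tb , b⊥d tb ]′ ∘ T-∨⇒⊎)) ⟩
    𝟙 a + (𝟙 b + 𝟙 (c ∨ d))       ≡⟨ cong (λ x → 𝟙 a + (𝟙 b + x)) (𝟙-∨-exclusive c d c⊥d) ⟩
    𝟙 a + (𝟙 b + (𝟙 c + 𝟙 d))     ∎
    where
    open ≡-Reasoning
    a = u ≡ᵇ h + v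
    b = v ≡ᵇ h + u
    c = (v ≡ᵇ 0) ∧ inStar u
    d = (u ≡ᵇ 0) ∧ inStar v

    split : ∀ x y → T ((x ≡ᵇ 0) ∧ inStar y) → x ≡ 0 × T (inStar y)
    split zero y y∈ = refl , y∈

    h+0∉Star : ¬ T (inStar (h + 0))
    h+0∉Star = subst (λ w → ¬ T (inStar w)) (sym (+-identityʳ h)) h∉Star

    a⊥b : T a → ¬ T b
    a⊥b ta tb with ≡ᵇ⇒≡ u (h + v) ta | ≡ᵇ⇒≡ v (h + u) tb
    ... | refl | v≡2h+v = <-irrefl v≡2h+v (≤-trans (m<n+m v z<s) (m≤n+m (h + v) h))
    a⊥c : T a → ¬ T c
    a⊥c ta tc with ≡ᵇ⇒≡ u (h + v) ta | split v u tc
    ... | refl | refl , u∈ = h+0∉Star u∈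
    a⊥d : T a → ¬ T d
    a⊥d ta td with ≡ᵇ⇒≡ u (h + v) ta | split u v td
    ... | refl | ()
    b⊥c : T b → ¬ T c
    b⊥c tb tc with ≡ᵇ⇒≡ v (h + u) tb | split v u tc
    ... | refl | ()
    b⊥d : T b → ¬ T d
    b⊥d tb td with ≡ᵇ⇒≡ v (h + u) tb | split u v td
    ... | refl | refl , v∈ = h+0∉Star v∈
    c⊥d : T c → ¬ T d
    c⊥d tc td with split u v td
    ... | refl , _ = proj₂ (split v 0 tc)

  removed-irrefl : ∀ v → removed v v ≡ false
  removed-irrefl v rewrite ≢⇒≡ᵇ-false (<⇒≢ (m<n+m v (z<s {h-1}))) = centre-notLeaf v
    where
    centre-notLeaf : ∀ w → ((w ≡ᵇ 0) ∧ inStar w) ∨ ((w ≡ᵇ 0) ∧ inStar w) ≡ false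
    centre-notLeaf zero    = refl
    centre-notLeaf (suc w) = refl

  open Complement removed removed-sym removed-irrefl public

  private
    closed+≡1 : ∀ v u {e} → 𝟙 (removed v u) ≡ e → 𝟙 (closedᶜ v u) + e ≡ 1
    closed+≡1 v u refl = 𝟙-closedᶜ+𝟙-R≡1 v u

  closed-h+ : ∀ m u → m < h → u < n → 𝟙 (closedᶜ (h + m) u) + 𝟙 (u ≡ᵇ m) ≡ 1
  closed-h+ m u m<h u<n = closed+≡1 (h + m) u removed-h+m
    where
    u<h+h+m : u < h + (h + m)
    u<h+h+m = <-≤-trans u<n (subst (_≤ h + (h + m)) (sym n≡h+h) (+-monoʳ-≤ h (m≤m+n h m)))
    removed-h+m : 𝟙 (removed (h + m) u) ≡ 𝟙 (u ≡ᵇ m)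
    removed-h+m rewrite 𝟙-removed (h + m) u | ≢⇒≡ᵇ-false (<⇒≢ u<h+h+m) | +-cancelˡ-≡ᵇ h m u | ≡ᵇ-sym m u
                      | inStar-false (<-≤-trans k<h (m≤m+n h m)) | ∧-zeroʳ (u ≡ᵇ 0)
                      = +-identityʳ _

  closed-outsideStar : ∀ j u → k < j → j < h → 𝟙 (closedᶜ j u) + 𝟙 (u ≡ᵇ h + j) ≡ 1
  closed-outsideStar j u k<j j<h = closed+≡1 j u removed-j
    where
    removed-j : 𝟙 (removed j u) ≡ 𝟙 (u ≡ᵇ h + j)
    removed-j rewrite 𝟙-removed j u | ≢⇒≡ᵇ-false (<⇒≢ (<-≤-trans j<h (m≤m+n h u)))
                    | ≢⇒≡ᵇ-false (>⇒≢ (≤-<-trans z≤n k<j)) | inStar-false k<j | ∧-zeroʳ (u ≡ᵇ 0)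
                    = +-identityʳ _

  closed-leaf : ∀ j u → 1 ≤ j → j ≤ k → 𝟙 (closedᶜ j u) + (𝟙 (u ≡ᵇ h + j) + 𝟙 (u ≡ᵇ 0)) ≡ 1
  closed-leaf j u 1≤j j≤k = closed+≡1 j u removed-j
    where
    removed-j : 𝟙 (removed j u) ≡ 𝟙 (u ≡ᵇ h + j) + 𝟙 (u ≡ᵇ 0)
    removed-j rewrite 𝟙-removed j u | ≢⇒≡ᵇ-false (<⇒≢ (<-≤-trans (≤-<-trans j≤k k<h) (m≤m+n h u)))
                    | ≢⇒≡ᵇ-false (>⇒≢ 1≤j) | inStar-true 1≤j j≤k | ∧-identityʳ (u ≡ᵇ 0)
                    = refl

  closed-centre : ∀ u → 𝟙 (closedᶜ 0 u) + (𝟙 (u ≡ᵇ h) + 𝟙 (inStar u)) ≡ 1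
  closed-centre u = closed+≡1 0 u removed-0
    where
    removed-0 : 𝟙 (removed 0 u) ≡ 𝟙 (u ≡ᵇ h) + 𝟙 (inStar u)
    removed-0 rewrite 𝟙-removed 0 u | +-identityʳ h | ∧-zeroʳ (u ≡ᵇ 0)
                    = cong (𝟙 (u ≡ᵇ h) +_) (+-identityʳ _)

  inStar≡∑< : ∀ u → ∑< k (λ i → 𝟙 (u ≡ᵇ suc i)) ≡ 𝟙 (inStar u)
  inStar≡∑< zero    = ∑<-zero k (λ _ _ → refl)
  inStar≡∑< (suc u) = trans (∑<-cong k (λ i _ → cong 𝟙 (≡ᵇ-sym u i))) (by-cases (u <? k))
    where
    by-cases : Dec (u < k) → ∑< k (λ i → 𝟙 (i ≡ᵇ u)) ≡ 𝟙 (inStar (suc u))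
    by-cases (yes u<k) = trans (∑<-count≡1 k u u<k) (cong 𝟙 (sym (inStar-true (s≤s z≤n) u<k)))
    by-cases (no  u≮k) = trans (∑<-count≡0 k u (≮⇒≥ u≮k)) (cong 𝟙 (sym (inStar-false (s≤s (≮⇒≥ u≮k)))))

  k<n : k < n
  k<n = <h⇒<n k<h

  ∑<-inStar : ∑< n (λ v → 𝟙 (inStar v)) ≡ k
  ∑<-inStar = begin
    ∑< n (λ v → 𝟙 (inStar v))                   ≡⟨ ∑<-cong n (λ v _ → sym (inStar≡∑< v)) ⟩
    ∑< n (λ v → ∑< k (λ i → 𝟙 (v ≡ᵇ suc i)))    ≡⟨ ∑<-comm n k _ ⟩
    ∑< k (λ i → ∑< n (λ v → 𝟙 (v ≡ᵇ suc i)))    ≡⟨ ∑<-cong k (λ i i<k → ∑<-count≡1 n (suc i) (≤-<-trans i<k k<n)) ⟩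
    ∑< k (λ _ → 1)                              ≡⟨ trans (∑<-const k 1) (*-identityʳ k) ⟩
    k                                           ∎
    where open ≡-Reasoning

  matching-degree : ∀ u → u < n → ∑< n (λ v → 𝟙 (v ≡ᵇ h + u)) + ∑< n (λ v → 𝟙 (u ≡ᵇ h + v)) ≡ 1
  matching-degree u u<n with u <? h
  ... | yes u<h = cong₂ _+_ (∑<-count≡1 n (h + u) (h+m<n u<h))
                            (∑<-zero n (λ v _ → cong 𝟙 (≢⇒≡ᵇ-false (<⇒≢ (<-≤-trans u<h (m≤m+n h v))))))
  ... | no  u≮h = cong₂ _+_ (∑<-count≡0 n (h + u) (subst (_≤ h + u) (sym n≡h+h) (+-monoʳ-≤ h h≤u)))
                            (trans (∑<-cong n (λ v _ → cong 𝟙 partner)) (∑<-count≡1 n (u ∸ h) (≤-<-trans (m∸n≤m u h) u<n)))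
    where
    h≤u = ≮⇒≥ u≮h
    partner : ∀ {v} → (u ≡ᵇ h + v) ≡ (v ≡ᵇ u ∸ h)
    partner {v} = begin
      (u ≡ᵇ h + v)           ≡⟨ cong (_≡ᵇ h + v) (sym (m+[n∸m]≡n h≤u)) ⟩
      (h + (u ∸ h) ≡ᵇ h + v) ≡⟨ +-cancelˡ-≡ᵇ h (u ∸ h) v ⟩
      (u ∸ h ≡ᵇ v)           ≡⟨ ≡ᵇ-sym (u ∸ h) v ⟩
      (v ≡ᵇ u ∸ h)           ∎
      where open ≡-Reasoning

  removed-degree : ∀ u → u < n → ∑< n (λ v → 𝟙 (removed v u)) ≡ 1 + (𝟙 (u ≡ᵇ 0) * k + 𝟙 (inStar u))
  removed-degree u u<n = begin
    ∑< n (λ v → 𝟙 (removed v u))                ≡⟨ ∑<-cong n (λ v _ → trans (cong 𝟙 (removed-sym v u)) (𝟙-removed u v)) ⟩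
    ∑< n (λ v → a v + (b v + (c v + d v)))       ≡⟨ ∑<-+ n a _ ⟩
    ∑< n a + ∑< n (λ v → b v + (c v + d v))      ≡⟨ cong (∑< n a +_) (trans (∑<-+ n b _) (cong (∑< n b +_) (∑<-+ n c d))) ⟩
    ∑< n a + (∑< n b + (∑< n c + ∑< n d))        ≡⟨ sym (+-assoc (∑< n a) _ _) ⟩
    ∑< n a + ∑< n b + (∑< n c + ∑< n d)          ≡⟨ cong₂ _+_ (matching-degree u u<n) (cong₂ _+_ ∑<-c ∑<-d) ⟩
    1 + (𝟙 (u ≡ᵇ 0) * k + 𝟙 (inStar u))          ∎
    where
    open ≡-Reasoning
    a b c d : ℕ → ℕ
    a v = 𝟙 (v ≡ᵇ h + u)
    b v = 𝟙 (u ≡ᵇ h + v)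
    c v = 𝟙 ((u ≡ᵇ 0) ∧ inStar v)
    d v = 𝟙 ((v ≡ᵇ 0) ∧ inStar u)

    ∑<-c : ∑< n c ≡ 𝟙 (u ≡ᵇ 0) * k
    ∑<-c = trans (∑<-cong n (λ v _ → 𝟙-∧ (u ≡ᵇ 0) (inStar v)))
                 (trans (∑<-distribˡ n (𝟙 (u ≡ᵇ 0)) _) (cong (𝟙 (u ≡ᵇ 0) *_) ∑<-inStar))

    ∑<-d : ∑< n d ≡ 𝟙 (inStar u)
    ∑<-d = trans (∑<-cong n (λ v _ → trans (𝟙-∧ (v ≡ᵇ 0) (inStar u)) (*-comm (𝟙 (v ≡ᵇ 0)) _)))
                 (∑<-select n 0 (λ _ → 𝟙 (inStar u)) (≤-<-trans z≤n k<n))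

  closed-degree : ∀ u → u < n → ∑< n (λ v → 𝟙 (closedᶜ v u)) + (1 + (𝟙 (u ≡ᵇ 0) * k + 𝟙 (inStar u))) ≡ n
  closed-degree u u<n = begin
    ∑< n (λ v → 𝟙 (closedᶜ v u)) + (1 + (𝟙 (u ≡ᵇ 0) * k + 𝟙 (inStar u))) ≡⟨ cong (∑< n (λ v → 𝟙 (closedᶜ v u)) +_) (sym (removed-degree u u<n)) ⟩
    ∑< n (λ v → 𝟙 (closedᶜ v u)) + ∑< n (λ v → 𝟙 (removed v u))          ≡⟨ ∑<-partition n (λ v _ → 𝟙-closedᶜ+𝟙-R≡1 v u) ⟩
    n                                                                      ∎
    where open ≡-Reasoning

  closed-leafPartners : ∀ u → u < n → ∑< k (λ i → 𝟙 (closedᶜ (h + suc i) u)) + 𝟙 (inStar u) ≡ k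
  closed-leafPartners u u<n = begin
    ∑< k (λ i → 𝟙 (closedᶜ (h + suc i) u)) + 𝟙 (inStar u)                 ≡⟨ cong (∑< k (λ i → 𝟙 (closedᶜ (h + suc i) u)) +_) (sym (inStar≡∑< u)) ⟩
    ∑< k (λ i → 𝟙 (closedᶜ (h + suc i) u)) + ∑< k (λ i → 𝟙 (u ≡ᵇ suc i)) ≡⟨ ∑<-partition k (λ i i<k → closed-h+ (suc i) u (≤-<-trans i<k k<h) u<n) ⟩
    k                                                                     ∎
    where open ≡-Reasoning

  matching-size : ∑< n (λ i → ∑< n (λ j → 𝟙 (j ≡ᵇ h + i))) ≡ h
  matching-size = begin
    ∑< n partners                                  ≡⟨ cong (λ m → ∑< m partners) n≡h+h ⟩
    ∑< (h + h) partners                            ≡⟨ ∑<-split h h partners ⟩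
    ∑< h partners + ∑< h (λ i → partners (h + i))  ≡⟨ cong₂ _+_ (∑<-cong h (λ i i<h → ∑<-count≡1 n (h + i) (h+m<n i<h)))
                                                              (∑<-zero h (λ i _ → ∑<-count≡0 n (h + (h + i)) n≤h+h+i)) ⟩
    ∑< h (λ _ → 1) + 0                             ≡⟨ trans (+-identityʳ _) (trans (∑<-const h 1) (*-identityʳ h)) ⟩
    h                                              ∎
    where
    open ≡-Reasoning
    partners : ℕ → ℕ
    partners i = ∑< n (λ j → 𝟙 (j ≡ᵇ h + i))
    n≤h+h+i : ∀ {i} → n ≤ h + (h + i)
    n≤h+h+i {i} = subst (_≤ h + (h + i)) (sym n≡h+h) (+-monoʳ-≤ h (m≤m+n h i))

  removedPairs≤h+k : ∑< n (λ i → ∑< n (λ j → 𝟙 (removed i j ∧ (i <ᵇ j)))) ≤ h + k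
  removedPairs≤h+k = begin
    ∑< n (λ i → ∑< n (λ j → 𝟙 (removed i j ∧ (i <ᵇ j))))                   ≤⟨ ∑<-mono-≤ n (λ i _ → ∑<-mono-≤ n (λ j _ → removed-upward i j)) ⟩
    ∑< n (λ i → ∑< n (λ j → 𝟙 (j ≡ᵇ h + i) + 𝟙 (i ≡ᵇ 0) * 𝟙 (inStar j)))  ≡⟨ ∑<-cong n (λ i _ → ∑<-+ n _ _) ⟩
    ∑< n (λ i → ∑< n (λ j → 𝟙 (j ≡ᵇ h + i)) + ∑< n (λ j → 𝟙 (i ≡ᵇ 0) * 𝟙 (inStar j)))
                                                                            ≡⟨ ∑<-+ n _ _ ⟩
    ∑< n (λ i → ∑< n (λ j → 𝟙 (j ≡ᵇ h + i))) + ∑< n (λ i → ∑< n (λ j → 𝟙 (i ≡ᵇ 0) * 𝟙 (inStar j)))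
                                                                            ≡⟨ cong₂ _+_ matching-size star-size ⟩
    h + k                                                                   ∎
    where
    open ≤-Reasoning
    removed-upward< : ∀ i j → i < j → 𝟙 (removed i j) ≤ 𝟙 (j ≡ᵇ h + i) + 𝟙 (i ≡ᵇ 0) * 𝟙 (inStar j)
    removed-upward< i j i<j
      rewrite 𝟙-removed i j | ≢⇒≡ᵇ-false (<⇒≢ (<-≤-trans i<j (m≤n+m j h))) | ≢⇒≡ᵇ-false (>⇒≢ (≤-<-trans z≤n i<j))
            | 𝟙-∧ (i ≡ᵇ 0) (inStar j)
            = ≤-reflexive (cong (𝟙 (j ≡ᵇ h + i) +_) (+-identityʳ _))
    removed-upward : ∀ i j → 𝟙 (removed i j ∧ (i <ᵇ j)) ≤ 𝟙 (j ≡ᵇ h + i) + 𝟙 (i ≡ᵇ 0) * 𝟙 (inStar j)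
    removed-upward i j with i <ᵇ j in i<ᵇj
    ... | false rewrite ∧-zeroʳ (removed i j) = z≤n
    ... | true  rewrite ∧-identityʳ (removed i j) = removed-upward< i j (<ᵇ⇒< i j (subst T (sym i<ᵇj) _))
    star-size : ∑< n (λ i → ∑< n (λ j → 𝟙 (i ≡ᵇ 0) * 𝟙 (inStar j))) ≡ k
    star-size = begin-equality
      ∑< n (λ i → ∑< n (λ j → 𝟙 (i ≡ᵇ 0) * 𝟙 (inStar j)))  ≡⟨ ∑<-cong n (λ i _ → trans (∑<-distribˡ n (𝟙 (i ≡ᵇ 0)) (λ j → 𝟙 (inStar j))) (cong (𝟙 (i ≡ᵇ 0) *_) ∑<-inStar)) ⟩
      ∑< n (λ i → 𝟙 (i ≡ᵇ 0) * k)                          ≡⟨ ∑<-cong n (λ i _ → *-comm (𝟙 (i ≡ᵇ 0)) k) ⟩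
      ∑< n (λ i → k * 𝟙 (i ≡ᵇ 0))                          ≡⟨ ∑<-select n 0 (λ _ → k) (≤-<-trans z≤n k<n) ⟩
      k                                                    ∎

  edgeCount≥ : n C 2 ∸ (n / 2 + k) ≤ edgeCount (complement n)
  edgeCount≥ = begin
    n C 2 ∸ (n / 2 + k)                                ≡⟨ cong (λ x → n C 2 ∸ (x + k)) (m*n/n≡m h 2) ⟩
    n C 2 ∸ (h + k)                                    ≤⟨ ∸-monoʳ-≤ (n C 2) removedPairs≤h+k ⟩
    n C 2 ∸ removedPairs                               ≡⟨ cong (_∸ removedPairs) (sym (edgeCount-complement n)) ⟩
    edgeCount (complement n) + removedPairs ∸ removedPairs ≡⟨ m+n∸n≡m _ removedPairs ⟩
    edgeCount (complement n)                           ∎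
    where
    open ≤-Reasoning
    removedPairs : ℕ
    removedPairs = ∑< n (λ i → ∑< n (λ j → 𝟙 (removed i j ∧ (i <ᵇ j))))

  module Winnable (l : ℕ) (coprime : gcd n-2k-1 (suc l) ≡ 1) where
    open Modulo l
    open LightsOut (complement n) l

    Reachable-closedᶜ : ∀ v → v < n → Reachable (λ u → 𝟙 (closedᶜ v (toℕ u)))
    Reachable-closedᶜ v v<n = Reachable-cong (λ u → ≡⇒≋ (cong 𝟙 (trans (inClosedNbhd-complement (fromℕ< v<n) u)
                                                                      (cong (λ x → closedᶜ x (toℕ u)) (toℕ-fromℕ< v<n)))))
                                             (Reachable-closedNbhd (fromℕ< v<n))

    combination : ℕ → ℕ
    combination u = ∑< n (λ v → 𝟙 (closedᶜ v u)) + l * ∑< k (λ i → 𝟙 (closedᶜ (h + suc i) u))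
                    + l * k * 𝟙 (closedᶜ (h + 0) u)

    Reachable-combination : Reachable (λ u → combination (toℕ u))
    Reachable-combination =
      Reachable-+ (Reachable-+ (Reachable-∑< n (λ v u → 𝟙 (closedᶜ v (toℕ u))) Reachable-closedᶜ)
                               (Reachable-* l (Reachable-∑< k (λ i u → 𝟙 (closedᶜ (h + suc i) (toℕ u)))
                                                              (λ i i<k → Reachable-closedᶜ _ (h+m<n (≤-<-trans i<k k<h))))))
                  (Reachable-* (l * k) (Reachable-closedᶜ (h + 0) (h+m<n z<s)))

    combination≋n-2k-1 : ∀ u → u < n → combination u ≋ n-2k-1
    combination≋n-2k-1 u u<n = +-*ℓ⇒≋ _ n-2k-1 0 (B + k * H) (+-cancelʳ-≡ (2 * k + 1) _ _ (begin
      combination u + 0 + (2 * k + 1)                   ≡⟨ cong₂ _+_ (+-identityʳ _) (rearrange₁ k) ⟩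
      combination u + (1 + k + k * 1)                   ≡⟨ cong (λ x → combination u + (1 + x + k * 1)) (sym eB) ⟩
      combination u + (1 + (B + s) + k * 1)             ≡⟨ cong (λ x → combination u + (1 + (B + s) + k * x)) (sym eH) ⟩
      combination u + (1 + (B + s) + k * (H + z))       ≡⟨ rearrange₂ A B H s z k l ⟩
      A + (1 + (z * k + s)) + (B + k * H) * ℓ           ≡⟨ cong (_+ (B + k * H) * ℓ) (trans (closed-degree u u<n) (sym n-2k-1+[2k+1]≡n)) ⟩
      n-2k-1 + (2 * k + 1) + (B + k * H) * ℓ            ≡⟨ +-comm-middle n-2k-1 (2 * k + 1) _ ⟩
      n-2k-1 + (B + k * H) * ℓ + (2 * k + 1)            ∎))
      where
      open ≡-Reasoning
      A = ∑< n (λ v → 𝟙 (closedᶜ v u))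
      B = ∑< k (λ i → 𝟙 (closedᶜ (h + suc i) u))
      H = 𝟙 (closedᶜ (h + 0) u)
      s = 𝟙 (inStar u)
      z = 𝟙 (u ≡ᵇ 0)
      eB : B + s ≡ k
      eB = closed-leafPartners u u<n
      eH : H + z ≡ 1
      eH = closed-h+ 0 u z<s u<n
      rearrange₁ : ∀ k → 2 * k + 1 ≡ 1 + k + k * 1
      rearrange₁ = solve-∀
      rearrange₂ : ∀ A B H s z k l → A + l * B + l * k * H + (1 + (B + s) + k * (H + z))
                                     ≡ A + (1 + (z * k + s)) + (B + k * H) * suc l
      rearrange₂ = solve-∀
      +-comm-middle : ∀ a b c → a + b + c ≡ a + c + b
      +-comm-middle = solve-∀

    Reachable-allOnes : Reachable (λ _ → 1)
    Reachable-allOnes with coprime⇒invertible n-2k-1 coprime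
    ... | d , dc≋1 = Reachable-cong (λ u → ≋-trans (*-congˡ-≋ d (combination≋n-2k-1 (toℕ u) (toℕ<n u))) dc≋1)
                                    (Reachable-* d Reachable-combination)

    δ : ℕ → Fin n → ℕ
    δ m u = 𝟙 (toℕ u ≡ᵇ m)

    Reachable-δ-low : ∀ m → m < h → Reachable (δ m)
    Reachable-δ-low m m<h = Reachable-∸ (Reachable-closedᶜ (h + m) (h+m<n m<h)) Reachable-allOnes
                                        (λ u → closed-h+ m (toℕ u) m<h (toℕ<n u))

    Reachable-δ-outsideStar : ∀ j → k < j → j < h → Reachable (δ (h + j))
    Reachable-δ-outsideStar j k<j j<h = Reachable-∸ (Reachable-closedᶜ j (<h⇒<n j<h)) Reachable-allOnes
                                                    (λ u → closed-outsideStar j (toℕ u) k<j j<h)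

    Reachable-δ-leafPartner : ∀ j → 1 ≤ j → j ≤ k → Reachable (δ (h + j))
    Reachable-δ-leafPartner j 1≤j j≤k =
      Reachable-∸ (Reachable-closedᶜ j (<h⇒<n (≤-<-trans j≤k k<h))) (Reachable-closedᶜ (h + 0) (h+m<n z<s))
                  (λ u → +-cancelʳ-≡ (𝟙 (toℕ u ≡ᵇ 0)) _ _ (begin
                    𝟙 (closedᶜ j (toℕ u)) + δ (h + j) u + 𝟙 (toℕ u ≡ᵇ 0)   ≡⟨ +-assoc (𝟙 (closedᶜ j (toℕ u))) (δ (h + j) u) _ ⟩
                    𝟙 (closedᶜ j (toℕ u)) + (δ (h + j) u + 𝟙 (toℕ u ≡ᵇ 0)) ≡⟨ closed-leaf j (toℕ u) 1≤j j≤k ⟩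
                    1                                                     ≡⟨ closed-h+ 0 (toℕ u) z<s (toℕ<n u) ⟨
                    𝟙 (closedᶜ (h + 0) (toℕ u)) + 𝟙 (toℕ u ≡ᵇ 0)           ∎))
      where open ≡-Reasoning

    Reachable-δ-hub : Reachable (δ h)
    Reachable-δ-hub = Reachable-∸ (Reachable-+ (Reachable-closedᶜ 0 (<h⇒<n z<s)) Reachable-star) Reachable-allOnes
                                  (λ u → trans (+-assoc-swap (𝟙 (closedᶜ 0 (toℕ u))) _ (δ h u)) (closed-centre (toℕ u)))
      where
      Reachable-star : Reachable (λ u → 𝟙 (inStar (toℕ u)))
      Reachable-star = Reachable-cong (λ u → ≡⇒≋ (inStar≡∑< (toℕ u)))
                         (Reachable-∑< k (λ i → δ (suc i)) (λ i i<k → Reachable-δ-low (suc i) (≤-<-trans i<k k<h)))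
      +-assoc-swap : ∀ a b c → a + b + c ≡ a + (c + b)
      +-assoc-swap = solve-∀

    Reachable-δ : ∀ m → m < n → Reachable (δ m)
    Reachable-δ m m<n with m <? h
    ... | yes m<h = Reachable-δ-low m m<h
    ... | no  m≮h = subst (Reachable ∘ δ) (m+[n∸m]≡n (≮⇒≥ m≮h)) (high (m ∸ h) m∸h<h)
      where
      m∸h<h : m ∸ h < h
      m∸h<h = subst (m ∸ h <_) (m+n∸m≡n h h) (∸-monoˡ-< (subst (m <_) n≡h+h m<n) (≮⇒≥ m≮h))
      high : ∀ j → j < h → Reachable (δ (h + j))
      high zero    _   = subst (Reachable ∘ δ) (sym (+-identityʳ h)) Reachable-δ-hub
      high (suc j) j<h with suc j ≤? k
      ... | yes j≤k = Reachable-δ-leafPartner (suc j) (s≤s z≤n) j≤k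
      ... | no  j≰k = Reachable-δ-outsideStar (suc j) (≰⇒> j≰k) j<h

    winnable : N-AW (suc l) (complement n)
    winnable = unitVectors⇒N-AW Reachable-δ

edgeless : ∀ ℓ m → MaxAtLeast 0 ℓ (0 ∸ m)
edgeless ℓ m = record { adj = λ () ; symm = λ () ; irrefl = λ () } , (λ _ → [] , λ ()) , ≤-reflexive (0∸n≡0 m)

-- j = h − 1 gives n − 2j − 1 = 1, which is coprime to everything.
leastCoprimeShift<half : ∀ h-1 ℓ k → IsLeastCoprimeShift (suc h-1 * 2) ℓ k → k < suc h-1
leastCoprimeShift<half h-1 ℓ k (_ , least) with suc h-1 ≤? k
... | no  h≰k = ≰⇒> h≰k
... | yes h≤k = contradiction (trans (cong (λ x → gcd x ℓ) distance≡1) (gcd-zeroˡ ℓ)) (least h-1 h≤k)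
  where
  distance≡1 : ∣ suc h-1 * 2 - (2 * h-1 + 1) ∣ ≡ 1
  distance≡1 = begin
    ∣ suc h-1 * 2 - (2 * h-1 + 1) ∣       ≡⟨ cong ∣_- 2 * h-1 + 1 ∣ (rearrange h-1) ⟩
    ∣ (2 * h-1 + 1) + 1 - (2 * h-1 + 1) ∣ ≡⟨ ∣-∣-comm (2 * h-1 + 1 + 1) _ ⟩
    ∣ (2 * h-1 + 1) - (2 * h-1 + 1) + 1 ∣ ≡⟨ ∣m-m+n∣≡n (2 * h-1 + 1) 1 ⟩
    1                                     ∎
    where
    open ≡-Reasoning
    rearrange : ∀ x → suc x * 2 ≡ 2 * x + 1 + 1
    rearrange = solve-∀

proposition4p5 : (n ℓ k : ℕ) → 2 ≤ ℓ → 2 ∣ n → 2 ∣ ℓ →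
    IsLeastCoprimeShift n ℓ k →
    MaxAtLeast n ℓ ((n C 2) ∸ (n / 2 + k))
proposition4p5 .(zero * 2)    ℓ k _ (divides zero refl) _ _ = edgeless ℓ (0 / 2 + k)
proposition4p5 .(suc h-1 * 2) (suc l) k _ (divides (suc h-1) refl) _ least@(coprime , _) =
  complement n , winnable , edgeCount≥
  where
  open MatchingPlusStar h-1 k (leastCoprimeShift<half h-1 (suc l) k least)
  open Winnable l coprime
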